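{- Let $X$ be an orientable map with transition matrix $U$. (i) Let $\tau>0$ be odd. Then $X$ is periodic at time $\tau$ if and only if $\operatorname{col}(U^{(\tau+1)/2}\hat N)\subseteq\operatorname{col}(\hat M)$. In particular, if $X$ is periodic at time $\tau$, then $|V|\le|F|$. (ii) $X$ is periodic at time $1$ if and only if $|V|=1$.
   Context: An orientable map $X$ is a 2-cell embedding of a finite connected multigraph (loops and parallel edges allowed) in a closed orientable surface, with vertex set $V$ and face set $F$. Each edge gives two arcs on opposite sides of it, pointing in opposite directions, each lying in a face and oriented along its clockwise facial walk. Let $\mathcal A$ be the arc set, $v(a)$ the tail vertex and $f(a)$ the face of arc $a$; $N\in\{0,1\}^{\mathcal A\times V}$ with $N(a,w)=1$ iff $w=v(a)$; $M\in\{0,1\}^{\mathcal A\times F}$ with $M(a,f)=1$ iff $f=f(a)$; $D=N^TN$, $\Delta=M^TM$; $\hat N=ND^{ -1/2}$, $\hat M=M\Delta^{ -1/2}$, $Q=\hat N\hat N^T$, $P=\hat M\hat M^T$; $U=(2P-I)(2Q-I)$. $\operatorname{col}(\cdot)$ denotes column space. $X$ is periodic at time $\tau$ if $U^\tau\hat N=\hat N$. -}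

module Defs where

open import Level using (Level; _⊔_; 0ℓ)
open import Data.Nat using (ℕ; zero; suc; _<_)
open import Data.Fin using (Fin; zero; suc; _≟_)
open import Data.Product using (∃; Σ; _×_; _,_)
open import Data.Bool using (if_then_else_)
open import Function using (_∘_; _⇔_)
open import Function.Definitions using (Injective)
open import Relation.Nullary using (¬_; does)
open import Relation.Binary using (Rel)
open import Relation.Binary.PropositionalEquality using (_≡_; _≢_)
open import Relation.Binary.Construct.Closure.ReflexiveTransitive using (Star)
open import Algebra.Bundles using (CommutativeRing)

iter : ∀ {a} {A : Set a} → (A → A) → ℕ → A → A
iter f zero    x = x
iter f (suc k) x = f (iter f k x)

-- Orientable maps, encoded combinatorially (rotation systems).
-- Arcs (darts) are Fin nA.  σ : rotation (next arc with the same tail,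
-- in the cyclic order around the vertex); α : reverse arc on the other
-- side of the same edge (fixed-point-free involution).  The facial walk
-- successor of arc a is φ a = σ (α a) (it starts at the head of a).
-- Vertices = σ-orbits, faces = φ-orbits; they are labelled by Fin nV,
-- Fin nF via surjections vtx (= v(a), the tail) and fac (= f(a)).

data Step {n : ℕ} (σ α : Fin n → Fin n) : Rel (Fin n) 0ℓ where
  σ-step : ∀ a → Step σ α a (σ a)
  α-step : ∀ a → Step σ α a (α a)

record OrientableMap : Set where
  field
    nA nV nF  : ℕ
    nonempty  : 0 < nA
    σ α       : Fin nA → Fin nA
    σ-inj     : Injective _≡_ _≡_ σ
    α-invol   : ∀ a → α (α a) ≡ a
    α-fpf     : ∀ a → α a ≢ a
    connected : ∀ a b → Star (Step σ α) a b
    vtx       : Fin nA → Fin nV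
    vtx-surj  : ∀ w → ∃ λ a → vtx a ≡ w
    vtx-orbit : ∀ a b → (vtx a ≡ vtx b) ⇔ (∃ λ k → iter σ k a ≡ b)
    fac       : Fin nA → Fin nF
    fac-surj  : ∀ f → ∃ λ a → fac a ≡ f
    fac-orbit : ∀ a b → (fac a ≡ fac b) ⇔ (∃ λ k → iter (σ ∘ α) k a ≡ b)

module LinAlg {c ℓ : Level} (R : CommutativeRing c ℓ) where
  open CommutativeRing R using (Carrier; _≈_; _+_; _*_; _-_; 0#; 1#)

  Mat : ℕ → ℕ → Set c
  Mat m n = Fin m → Fin n → Carrier

  sumF : ∀ n → (Fin n → Carrier) → Carrier
  sumF zero    g = 0#
  sumF (suc n) g = g zero + sumF n (g ∘ suc)

  infixl 7 _⊗_
  _⊗_ : ∀ {m n p} → Mat m n → Mat n p → Mat m p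
  (A ⊗ B) i k = sumF _ (λ j → A i j * B j k)

  _ᵀ : ∀ {m n} → Mat m n → Mat n m
  (A ᵀ) j i = A i j

  idM : ∀ {n} → Mat n n
  idM i j = if does (i ≟ j) then 1# else 0#

  _⊕_ _⊖_ : ∀ {m n} → Mat m n → Mat m n → Mat m n
  (A ⊕ B) i j = A i j + B i j
  (A ⊖ B) i j = A i j - B i j

  diag : ∀ {n} → (Fin n → Carrier) → Mat n n
  diag r i j = if does (i ≟ j) then r i else 0#

  pow : ∀ {n} → Mat n n → ℕ → Mat n n
  pow A zero    = idM
  pow A (suc k) = A ⊗ pow A k

  _≈M_ : ∀ {m n} → Mat m n → Mat m n → Set ℓ
  A ≈M B = ∀ i j → A i j ≈ B i j

  ColSub : ∀ {m n p} → Mat m n → Mat m p → Set (c ⊔ ℓ)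
  ColSub {m} {n} {p} A B = ∃ λ (C : Mat p n) → A ≈M (B ⊗ C)

  fromℕ : ℕ → Carrier
  fromℕ zero    = 0#
  fromℕ (suc n) = 1# + fromℕ n

record IsChar0Field {c ℓ : Level} (R : CommutativeRing c ℓ) : Set (c ⊔ ℓ) where
  open CommutativeRing R using (_≈_; _*_; 0#; 1#)
  open LinAlg R
  field
    inverse : ∀ x → ¬ (x ≈ 0#) → ∃ λ y → x * y ≈ 1#
    char0   : ∀ n → ¬ (fromℕ (suc n) ≈ 0#)

module MapMatrices {c ℓ : Level} (R : CommutativeRing c ℓ) (X : OrientableMap) where
  open CommutativeRing R using (Carrier; _≈_; _*_; 0#; 1#)
  open LinAlg R public
  open OrientableMap X

  N : Mat nA nV
  N a w = if does (vtx a ≟ w) then 1# else 0#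

  M : Mat nA nF
  M a f = if does (fac a ≟ f) then 1# else 0#

  D : Mat nV nV
  D = (N ᵀ) ⊗ N

  Δ : Mat nF nF
  Δ = (M ᵀ) ⊗ M

  -- rV w plays the role of D(w,w)^{-1/2}: (rV w)² · D(w,w) = 1.
  IsInvSqrt : ∀ {n} → Mat n n → (Fin n → Carrier) → Set ℓ
  IsInvSqrt A r = ∀ i → (r i * r i) * A i i ≈ 1#

  module WithRoots (rV : Fin nV → Carrier) (rF : Fin nF → Carrier) where
    N̂ : Mat nA nV
    N̂ = N ⊗ diag rV

    M̂ : Mat nA nF
    M̂ = M ⊗ diag rF

    Q : Mat nA nA
    Q = N̂ ⊗ (N̂ ᵀ)

    P : Mat nA nA
    P = M̂ ⊗ (M̂ ᵀ)

    U : Mat nA nA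
    U = ((P ⊕ P) ⊖ idM) ⊗ ((Q ⊕ Q) ⊖ idM)

    Periodic : ℕ → Set ℓ
    Periodic τ = (pow U τ ⊗ N̂) ≈M N̂

{-# OPTIONS --safe #-}
-- N̂ and M̂ have orthonormal columns, so P and Q are the orthogonal projections onto col M̂ and
-- col N̂, and 2P − I, 2Q − I are involutions; hence U is invertible with inverse (2Q − I)(2P − I).
-- From (2Q − I)Uᵏ = U⁻ᵏ(2Q − I) and (2Q − I)N̂ = N̂ one gets (2P − I)Uᵏ⁺¹N̂ = U⁻ᵏN̂, so
-- U²ᵏ⁺¹N̂ = N̂ iff Uᵏ⁺¹N̂ is fixed by 2P − I, i.e. (as 2 is invertible) lies in col M̂. Then
-- N̂ᵀU⁻⁽ᵏ⁺¹⁾M̂ has a right inverse, so |V| ≤ |F| over a field. For τ = 1 the condition is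
-- col N̂ ⊆ col M̂: all arcs of a face then have the same tail, so v(a) = v(α a), and connectivity
-- leaves a single vertex.

module Submission where

open import Defs
open import Level using (Level)
open import Data.Nat using (ℕ; zero; suc; _*_; _≤_; _≤?_; z≤n; s≤s) renaming (_+_ to _+ℕ_)
import Data.Nat.Properties as ℕ
open import Data.Fin using (Fin; zero; suc; _≟_; fromℕ<)
open import Data.Fin.Properties using (punchInᵢ≢i)
open import Data.Vec.Functional using (removeAt)
open import Data.Product using (∃; ∃₂; _×_; _,_; proj₁; proj₂)
open import Function using (_∘_; _on_; _⇔_)
open import Function.Bundles using (mk⇔; Equivalence)
import Function.Properties.Equivalence as ⇔
open import Relation.Binary using (Setoid)
open import Relation.Binary.Construct.Closure.ReflexiveTransitive using (fold)
open import Relation.Binary.PropositionalEquality as P using (_≡_; _≢_)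
open import Data.Bool using (if_then_else_)
open import Data.Empty using (⊥-elim)
open import Relation.Nullary using (¬_; Dec; does; yes; no)
open import Relation.Nullary.Decidable using (dec-true; dec-false; decidable-stable)
open import Algebra.Bundles using (CommutativeRing)
import Relation.Binary.Reasoning.Setoid as SetoidReasoning

inhabited-subsingleton⇒≡1 : ∀ {n} → Fin n → (∀ (x y : Fin n) → x ≡ y) → n ≡ 1
inhabited-subsingleton⇒≡1 {suc zero}    _ _       = P.refl
inhabited-subsingleton⇒≡1 {suc (suc n)} _ all-≡ with all-≡ zero (suc zero)
... | ()

≡1⇒subsingleton : ∀ {n} → n ≡ 1 → ∀ (x y : Fin n) → x ≡ y
≡1⇒subsingleton P.refl zero zero = P.refl

module RingLemmas {c ℓ : Level} (R : CommutativeRing c ℓ) where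
  open CommutativeRing R hiding (zero) renaming (_*_ to _·_)
  open import Algebra.Properties.Ring ring using (⁻¹-anti-homo‿-)
  open import Algebra.Properties.CommutativeSemigroup +-commutativeSemigroup using (x∙yz≈y∙xz)
  open SetoidReasoning setoid

  x+x-x≈x : ∀ x → x + x - x ≈ x
  x+x-x≈x x = trans (+-assoc x x (- x)) (trans (+-congˡ (-‿inverseʳ x)) (+-identityʳ x))

  x-[x-y]≈y : ∀ x y → x - (x - y) ≈ y
  x-[x-y]≈y x y = begin
    x + - (x - y) ≈⟨ +-congˡ (⁻¹-anti-homo‿- x y) ⟩
    x + (y - x)   ≈⟨ x∙yz≈y∙xz x y (- x) ⟩
    y + (x - x)   ≈⟨ +-congˡ (-‿inverseʳ x) ⟩
    y + 0#        ≈⟨ +-identityʳ y ⟩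
    y             ∎

  module _ (half : Carrier) (two·half≈1 : (1# + 1#) · half ≈ 1#) where

    x+x≈y+y⇒x≈y : ∀ {x y} → x + x ≈ y + y → x ≈ y
    x+x≈y+y⇒x≈y {x} {y} x+x≈y+y = begin
      x                      ≈⟨ halve x ⟨
      half · (1# + 1#) · x   ≈⟨ *-assoc half _ x ⟩
      half · ((1# + 1#) · x) ≈⟨ *-congˡ (trans double (trans x+x≈y+y (sym double))) ⟩
      half · ((1# + 1#) · y) ≈⟨ *-assoc half _ y ⟨
      half · (1# + 1#) · y   ≈⟨ halve y ⟩
      y                      ∎
      where
      double : ∀ {z} → (1# + 1#) · z ≈ z + z
      double {z} = trans (distribʳ z 1# 1#) (+-cong (*-identityˡ z) (*-identityˡ z))
      halve : ∀ z → half · (1# + 1#) · z ≈ z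
      halve z = trans (*-congʳ (trans (*-comm half _) two·half≈1)) (*-identityˡ z)

    x+x-y≈y⇒x≈y : ∀ {x y} → x + x - y ≈ y → x ≈ y
    x+x-y≈y⇒x≈y {x} {y} e = x+x≈y+y⇒x≈y (begin
      x + x             ≈⟨ +-identityʳ (x + x) ⟨
      x + x + 0#        ≈⟨ +-congˡ (-‿inverseˡ y) ⟨
      x + x + (- y + y) ≈⟨ +-assoc (x + x) (- y) y ⟨
      x + x - y + y     ≈⟨ +-congʳ e ⟩
      y + y             ∎)

module MatrixAlgebra {c ℓ : Level} (R : CommutativeRing c ℓ) where
  open CommutativeRing R hiding (zero) renaming (_*_ to _·_)
  open LinAlg R
  open import Algebra.Properties.Ring ring using (x[y-z]≈xy-xz; [y-z]x≈yx-zx; -1*x≈-x)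
  open import Algebra.Properties.CommutativeSemigroup +-commutativeSemigroup
    using (interchange; x∙yz≈y∙xz)
  open import Algebra.Properties.CommutativeSemigroup *-commutativeSemigroup
    using () renaming (interchange to ·-interchange)
  open SetoidReasoning setoid

  sumF-cong : ∀ n {g h : Fin n → Carrier} → (∀ i → g i ≈ h i) → sumF n g ≈ sumF n h
  sumF-cong zero    g≈h = refl
  sumF-cong (suc n) g≈h = +-cong (g≈h zero) (sumF-cong n (g≈h ∘ suc))

  sumF-zero : ∀ n {g : Fin n → Carrier} → (∀ i → g i ≈ 0#) → sumF n g ≈ 0#
  sumF-zero zero    g≈0 = refl
  sumF-zero (suc n) g≈0 = trans (+-cong (g≈0 zero) (sumF-zero n (g≈0 ∘ suc))) (+-identityˡ 0#)

  sumF-distrib-+ : ∀ n (g h : Fin n → Carrier) →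
                   sumF n (λ i → g i + h i) ≈ sumF n g + sumF n h
  sumF-distrib-+ zero    g h = sym (+-identityˡ 0#)
  sumF-distrib-+ (suc n) g h =
    trans (+-congˡ (sumF-distrib-+ n (g ∘ suc) (h ∘ suc))) (interchange _ _ _ _)

  *-distribˡ-sumF : ∀ n x (g : Fin n → Carrier) → x · sumF n g ≈ sumF n (λ i → x · g i)
  *-distribˡ-sumF zero    x g = zeroʳ x
  *-distribˡ-sumF (suc n) x g = trans (distribˡ x _ _) (+-congˡ (*-distribˡ-sumF n x (g ∘ suc)))

  *-distribʳ-sumF : ∀ n x (g : Fin n → Carrier) → sumF n g · x ≈ sumF n (λ i → g i · x)
  *-distribʳ-sumF zero    x g = zeroˡ x
  *-distribʳ-sumF (suc n) x g = trans (distribʳ x _ _) (+-congˡ (*-distribʳ-sumF n x (g ∘ suc)))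

  sumF-neg : ∀ n (g : Fin n → Carrier) → sumF n (λ i → - g i) ≈ - sumF n g
  sumF-neg n g = begin
    sumF n (λ i → - g i)      ≈⟨ sumF-cong n (λ i → -1*x≈-x (g i)) ⟨
    sumF n (λ i → - 1# · g i) ≈⟨ *-distribˡ-sumF n (- 1#) g ⟨
    - 1# · sumF n g           ≈⟨ -1*x≈-x _ ⟩
    - sumF n g                ∎

  sumF-sub : ∀ n (g h : Fin n → Carrier) → sumF n (λ i → g i - h i) ≈ sumF n g - sumF n h
  sumF-sub n g h = trans (sumF-distrib-+ n g (λ i → - h i)) (+-congˡ (sumF-neg n h))

  sumF-comm : ∀ m n (g : Fin m → Fin n → Carrier) →
              sumF m (λ i → sumF n (g i)) ≈ sumF n (λ j → sumF m (λ i → g i j))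
  sumF-comm zero    n g = sym (sumF-zero n (λ _ → refl))
  sumF-comm (suc m) n g = trans (+-congˡ (sumF-comm m n (g ∘ suc)))
    (sym (sumF-distrib-+ n (g zero) (λ j → sumF m (λ i → g (suc i) j))))

  sumF-remove : ∀ {n} (i : Fin (suc n)) (g : Fin (suc n) → Carrier) →
                sumF (suc n) g ≈ g i + sumF n (removeAt g i)
  sumF-remove zero            g = refl
  sumF-remove {suc n} (suc i) g =
    trans (+-congˡ (sumF-remove i (g ∘ suc))) (x∙yz≈y∙xz _ _ _)

  sumF-single : ∀ {n} (i : Fin n) (g : Fin n → Carrier) →
                (∀ j → j ≢ i → g j ≈ 0#) → sumF n g ≈ g i
  sumF-single {suc n} i g g≈0 = begin
    sumF (suc n) g                 ≈⟨ sumF-remove i g ⟩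
    g i + sumF n (removeAt g i)    ≈⟨ +-congˡ (sumF-zero n (λ t → g≈0 _ (punchInᵢ≢i i t))) ⟩
    g i + 0#                       ≈⟨ +-identityʳ (g i) ⟩
    g i                            ∎

  ≈M-setoid : ℕ → ℕ → Setoid c ℓ
  ≈M-setoid m n = record
    { Carrier       = Mat m n
    ; _≈_           = _≈M_
    ; isEquivalence = record
      { refl  = λ i j → refl
      ; sym   = λ A≈B i j → sym (A≈B i j)
      ; trans = λ A≈B B≈C i j → trans (A≈B i j) (B≈C i j)
      }
    }

  module ≈M-Reasoning {m n : ℕ} = SetoidReasoning (≈M-setoid m n)

  module _ {m n : ℕ} where
    open Setoid (≈M-setoid m n) public
      using () renaming (refl to ≈M-refl; sym to ≈M-sym; trans to ≈M-trans)

  indicator : ∀ {m n} → (Fin m → Fin n) → Mat m n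
  indicator f a w = if does (f a ≟ w) then 1# else 0#

  indicator-≡ : ∀ {m n} (f : Fin m → Fin n) {a w} → f a ≡ w → indicator f a w ≈ 1#
  indicator-≡ f {a} {w} fa≡w rewrite dec-true (f a ≟ w) fa≡w = refl

  indicator-≢ : ∀ {m n} (f : Fin m → Fin n) {a w} → f a ≢ w → indicator f a w ≈ 0#
  indicator-≢ f {a} {w} fa≢w rewrite dec-false (f a ≟ w) fa≢w = refl

  diag-≡ : ∀ {n} (r : Fin n → Carrier) i → diag r i i ≈ r i
  diag-≡ r i rewrite dec-true (i ≟ i) P.refl = refl

  diag-≢ : ∀ {n} (r : Fin n → Carrier) {i j} → i ≢ j → diag r i j ≈ 0#
  diag-≢ r {i} {j} i≢j rewrite dec-false (i ≟ j) i≢j = refl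

  ⊗-diag : ∀ {m n} (A : Mat m n) (r : Fin n → Carrier) i k → (A ⊗ diag r) i k ≈ A i k · r k
  ⊗-diag A r i k = trans
    (sumF-single k _ (λ j j≢k → trans (*-congˡ (diag-≢ r j≢k)) (zeroʳ _)))
    (*-congˡ (diag-≡ r k))

  diag-⊗ : ∀ {m n} (r : Fin m → Carrier) (B : Mat m n) i k → (diag r ⊗ B) i k ≈ r i · B i k
  diag-⊗ r B i k = trans
    (sumF-single i _ (λ j j≢i → trans (*-congʳ (diag-≢ r (j≢i ∘ P.sym))) (zeroˡ _)))
    (*-congʳ (diag-≡ r i))

  indicator-⊗ : ∀ {m n p} (f : Fin m → Fin n) (B : Mat n p) a k →
                (indicator f ⊗ B) a k ≈ B (f a) k
  indicator-⊗ f B a k = trans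
    (sumF-single (f a) _ (λ w w≢fa → trans (*-congʳ (indicator-≢ f (w≢fa ∘ P.sym))) (zeroˡ _)))
    (trans (*-congʳ (indicator-≡ f P.refl)) (*-identityˡ _))

  ⊗-identityʳ : ∀ {m n} (A : Mat m n) → (A ⊗ idM) ≈M A
  ⊗-identityʳ A i k = trans (⊗-diag A (λ _ → 1#) i k) (*-identityʳ _)

  ⊗-identityˡ : ∀ {m n} (A : Mat m n) → (idM ⊗ A) ≈M A
  ⊗-identityˡ A i k = trans (diag-⊗ (λ _ → 1#) A i k) (*-identityˡ _)

  ⊗-cong : ∀ {m n p} {A A' : Mat m n} {B B' : Mat n p} → A ≈M A' → B ≈M B' → (A ⊗ B) ≈M (A' ⊗ B')
  ⊗-cong A≈A' B≈B' i k = sumF-cong _ (λ j → *-cong (A≈A' i j) (B≈B' j k))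

  ⊗-congˡ : ∀ {m n p} {A : Mat m n} {B B' : Mat n p} → B ≈M B' → (A ⊗ B) ≈M (A ⊗ B')
  ⊗-congˡ = ⊗-cong ≈M-refl

  ⊗-congʳ : ∀ {m n p} {A A' : Mat m n} {B : Mat n p} → A ≈M A' → (A ⊗ B) ≈M (A' ⊗ B)
  ⊗-congʳ A≈A' = ⊗-cong A≈A' ≈M-refl

  ⊗-assoc : ∀ {m n p q} (A : Mat m n) (B : Mat n p) (C : Mat p q) → ((A ⊗ B) ⊗ C) ≈M (A ⊗ (B ⊗ C))
  ⊗-assoc {n = n} {p} A B C i l = begin
    sumF p (λ k → sumF n (λ j → A i j · B j k) · C k l)
      ≈⟨ sumF-cong p (λ k → *-distribʳ-sumF n (C k l) _) ⟩
    sumF p (λ k → sumF n (λ j → A i j · B j k · C k l))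
      ≈⟨ sumF-comm n p _ ⟨
    sumF n (λ j → sumF p (λ k → A i j · B j k · C k l))
      ≈⟨ sumF-cong n (λ j → sumF-cong p (λ k → *-assoc _ _ _)) ⟩
    sumF n (λ j → sumF p (λ k → A i j · (B j k · C k l)))
      ≈⟨ sumF-cong n (λ j → *-distribˡ-sumF p (A i j) _) ⟨
    sumF n (λ j → A i j · sumF p (λ k → B j k · C k l))
      ∎

  ⊗-distribˡ-⊕ : ∀ {m n p} (A : Mat m n) (B C : Mat n p) → (A ⊗ (B ⊕ C)) ≈M ((A ⊗ B) ⊕ (A ⊗ C))
  ⊗-distribˡ-⊕ {n = n} A B C i k = trans (sumF-cong n (λ j → distribˡ _ _ _)) (sumF-distrib-+ n _ _)

  ⊗-distribʳ-⊕ : ∀ {m n p} (A B : Mat m n) (C : Mat n p) → ((A ⊕ B) ⊗ C) ≈M ((A ⊗ C) ⊕ (B ⊗ C))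
  ⊗-distribʳ-⊕ {n = n} A B C i k = trans (sumF-cong n (λ j → distribʳ _ _ _)) (sumF-distrib-+ n _ _)

  ⊗-distribˡ-⊖ : ∀ {m n p} (A : Mat m n) (B C : Mat n p) → (A ⊗ (B ⊖ C)) ≈M ((A ⊗ B) ⊖ (A ⊗ C))
  ⊗-distribˡ-⊖ {n = n} A B C i k = trans (sumF-cong n (λ j → x[y-z]≈xy-xz _ _ _)) (sumF-sub n _ _)

  ⊗-distribʳ-⊖ : ∀ {m n p} (A B : Mat m n) (C : Mat n p) → ((A ⊖ B) ⊗ C) ≈M ((A ⊗ C) ⊖ (B ⊗ C))
  ⊗-distribʳ-⊖ {n = n} A B C i k = trans (sumF-cong n (λ j → [y-z]x≈yx-zx _ _ _)) (sumF-sub n _ _)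

  ⊕-cong : ∀ {m n} {A A' B B' : Mat m n} → A ≈M A' → B ≈M B' → (A ⊕ B) ≈M (A' ⊕ B')
  ⊕-cong A≈A' B≈B' i j = +-cong (A≈A' i j) (B≈B' i j)

  ⊖-cong : ∀ {m n} {A A' B B' : Mat m n} → A ≈M A' → B ≈M B' → (A ⊖ B) ≈M (A' ⊖ B')
  ⊖-cong A≈A' B≈B' i j = +-cong (A≈A' i j) (-‿cong (B≈B' i j))

  idM-≡ : ∀ {n} (i : Fin n) → idM i i ≈ 1#
  idM-≡ = diag-≡ (λ _ → 1#)

  idM-≢ : ∀ {n} {i j : Fin n} → i ≢ j → idM i j ≈ 0#
  idM-≢ = diag-≢ (λ _ → 1#)

  ⊗-removeZeroRow : ∀ {m n p} (A : Mat m (suc n)) (B : Mat (suc n) p) (j : Fin (suc n)) →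
                    (∀ k → B j k ≈ 0#) → ((λ i → removeAt (A i) j) ⊗ removeAt B j) ≈M (A ⊗ B)
  ⊗-removeZeroRow {n = n} A B j Bj≈0 i k = sym (begin
    sumF (suc n) g                    ≈⟨ sumF-remove j g ⟩
    g j + sumF n (removeAt g j)       ≈⟨ +-congʳ (trans (*-congˡ (Bj≈0 k)) (zeroʳ _)) ⟩
    0# + sumF n (removeAt g j)        ≈⟨ +-identityˡ _ ⟩
    sumF n (removeAt g j)             ∎)
    where
    g : Fin (suc n) → Carrier
    g t = A i t · B t k

  indicator-diag-orthonormal :
    ∀ {m n} (f : Fin m → Fin n) (r : Fin n → Carrier) →
    (∀ w → (r w · r w) · ((indicator f ᵀ) ⊗ indicator f) w w ≈ 1#) →
    (((indicator f ⊗ diag r) ᵀ) ⊗ (indicator f ⊗ diag r)) ≈M idM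
  indicator-diag-orthonormal {m} f r normalised w w' = begin
    sumF m (λ a → (I ⊗ diag r) a w · (I ⊗ diag r) a w')
      ≈⟨ sumF-cong m (λ a → *-cong (⊗-diag I r a w) (⊗-diag I r a w')) ⟩
    sumF m (λ a → (I a w · r w) · (I a w' · r w'))
      ≈⟨ sumF-cong m (λ a → trans (·-interchange _ _ _ _) (*-comm _ _)) ⟩
    sumF m (λ a → (r w · r w') · (I a w · I a w'))
      ≈⟨ *-distribˡ-sumF m _ _ ⟨
    (r w · r w') · ((I ᵀ) ⊗ I) w w'
      ≈⟨ gram (w ≟ w') ⟩
    idM w w'
      ∎
    where
    I = indicator f
    disjoint : w ≢ w' → ∀ a → I a w · I a w' ≈ 0#
    disjoint w≢w' a with f a ≟ w
    ... | yes fa≡w = trans (*-identityˡ _)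
                           (indicator-≢ f (λ fa≡w' → w≢w' (P.trans (P.sym fa≡w) fa≡w')))
    ... | no _     = zeroˡ _
    gram : Dec (w ≡ w') → (r w · r w') · ((I ᵀ) ⊗ I) w w' ≈ idM w w'
    gram (yes P.refl) = trans (normalised w) (sym (idM-≡ w))
    gram (no w≢w')    = trans (trans (*-congˡ (sumF-zero m (disjoint w≢w'))) (zeroʳ _))
                              (sym (idM-≢ w≢w'))

  cancel-inverse : ∀ {m n p} (A : Mat m n) (B : Mat n m) → (A ⊗ B) ≈M idM →
                   (X : Mat m p) → (A ⊗ (B ⊗ X)) ≈M X
  cancel-inverse A B AB≈I X i k = trans (sym (⊗-assoc A B X i k))
    (trans (⊗-congʳ {B = X} AB≈I i k) (⊗-identityˡ X i k))

module MatrixPowers {c ℓ : Level} (R : CommutativeRing c ℓ) where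
  open LinAlg R
  open MatrixAlgebra R
  open ≈M-Reasoning

  pow-sucʳ : ∀ {m} (A : Mat m m) k → pow A (suc k) ≈M (pow A k ⊗ A)
  pow-sucʳ A zero    = ≈M-trans (⊗-identityʳ A) (≈M-sym (⊗-identityˡ A))
  pow-sucʳ A (suc k) = begin
    A ⊗ pow A (suc k)  ≈⟨ ⊗-congˡ (pow-sucʳ A k) ⟩
    A ⊗ (pow A k ⊗ A)  ≈⟨ ⊗-assoc A (pow A k) A ⟨
    A ⊗ pow A k ⊗ A    ∎

  pow-+ : ∀ {m} (A : Mat m m) k l → pow A (k +ℕ l) ≈M (pow A k ⊗ pow A l)
  pow-+ A zero    l = ≈M-sym (⊗-identityˡ (pow A l))
  pow-+ A (suc k) l = begin
    A ⊗ pow A (k +ℕ l)          ≈⟨ ⊗-congˡ (pow-+ A k l) ⟩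
    A ⊗ (pow A k ⊗ pow A l)     ≈⟨ ⊗-assoc A (pow A k) (pow A l) ⟨
    A ⊗ pow A k ⊗ pow A l       ∎

  pow-odd : ∀ {m} (A : Mat m m) k → pow A (suc (2 * k)) ≈M (pow A k ⊗ pow A (suc k))
  pow-odd A k =
    P.subst (λ t → pow A t ≈M (pow A k ⊗ pow A (suc k))) k+[1+k]≡1+2k (pow-+ A k (suc k))
    where
    k+[1+k]≡1+2k : k +ℕ suc k ≡ suc (2 * k)
    k+[1+k]≡1+2k = P.trans (ℕ.+-suc k k) (P.cong (λ t → suc (k +ℕ t)) (P.sym (ℕ.+-identityʳ k)))

  pow-intertwine : ∀ {m} (A B C : Mat m m) → (A ⊗ B) ≈M (C ⊗ A) →
                   ∀ k → (A ⊗ pow B k) ≈M (pow C k ⊗ A)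
  pow-intertwine A B C AB≈CA zero = ≈M-trans (⊗-identityʳ A) (≈M-sym (⊗-identityˡ A))
  pow-intertwine A B C AB≈CA (suc k) = begin
    A ⊗ (B ⊗ pow B k)    ≈⟨ ⊗-assoc A B (pow B k) ⟨
    A ⊗ B ⊗ pow B k      ≈⟨ ⊗-congʳ AB≈CA ⟩
    C ⊗ A ⊗ pow B k      ≈⟨ ⊗-assoc C A (pow B k) ⟩
    C ⊗ (A ⊗ pow B k)    ≈⟨ ⊗-congˡ (pow-intertwine A B C AB≈CA k) ⟩
    C ⊗ (pow C k ⊗ A)    ≈⟨ ⊗-assoc C (pow C k) A ⟨
    C ⊗ pow C k ⊗ A      ∎

  pow-inverse : ∀ {m} (A B : Mat m m) → (A ⊗ B) ≈M idM → ∀ k → (pow A k ⊗ pow B k) ≈M idM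
  pow-inverse A B AB≈I zero = ⊗-identityˡ idM
  pow-inverse A B AB≈I (suc k) = begin
    A ⊗ pow A k ⊗ pow B (suc k)    ≈⟨ ⊗-congˡ (pow-sucʳ B k) ⟩
    A ⊗ pow A k ⊗ (pow B k ⊗ B)    ≈⟨ ⊗-assoc A (pow A k) (pow B k ⊗ B) ⟩
    A ⊗ (pow A k ⊗ (pow B k ⊗ B))  ≈⟨ ⊗-congˡ (⊗-assoc (pow A k) (pow B k) B) ⟨
    A ⊗ (pow A k ⊗ pow B k ⊗ B)    ≈⟨ ⊗-congˡ (⊗-congʳ (pow-inverse A B AB≈I k)) ⟩
    A ⊗ (idM ⊗ B)                  ≈⟨ ⊗-congˡ (⊗-identityˡ B) ⟩
    A ⊗ B                          ≈⟨ AB≈I ⟩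
    idM                            ∎

module Reflection {c ℓ : Level} (R : CommutativeRing c ℓ) where
  open CommutativeRing R using (Carrier; _≈_; _+_; 1#) renaming (_*_ to _·_)
  open LinAlg R
  open MatrixAlgebra R
  open RingLemmas R
  open ≈M-Reasoning

  projector : ∀ {m n} → Mat m n → Mat m m
  projector H = H ⊗ (H ᵀ)

  reflection : ∀ {m n} → Mat m n → Mat m m
  reflection H = (projector H ⊕ projector H) ⊖ idM

  reflection-⊗ : ∀ {m n p} (H : Mat m n) (X : Mat m p) →
                 (reflection H ⊗ X) ≈M (((projector H ⊗ X) ⊕ (projector H ⊗ X)) ⊖ X)
  reflection-⊗ H X = begin
    ((E ⊕ E) ⊖ idM) ⊗ X                  ≈⟨ ⊗-distribʳ-⊖ (E ⊕ E) idM X ⟩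
    ((E ⊕ E) ⊗ X) ⊖ (idM ⊗ X)            ≈⟨ ⊖-cong (⊗-distribʳ-⊕ E E X) (⊗-identityˡ X) ⟩
    ((E ⊗ X) ⊕ (E ⊗ X)) ⊖ X              ∎
    where E = projector H

  module _ {m n : ℕ} (H : Mat m n) (HᵀH≈I : ((H ᵀ) ⊗ H) ≈M idM) where

    private
      E S : Mat m m
      E = projector H
      S = reflection H

    projector-⊗-self : (projector H ⊗ H) ≈M H
    projector-⊗-self = begin
      H ⊗ (H ᵀ) ⊗ H    ≈⟨ ⊗-assoc H (H ᵀ) H ⟩
      H ⊗ ((H ᵀ) ⊗ H)  ≈⟨ ⊗-congˡ HᵀH≈I ⟩
      H ⊗ idM          ≈⟨ ⊗-identityʳ H ⟩
      H                ∎

    projector-idempotent : (projector H ⊗ projector H) ≈M projector H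
    projector-idempotent =
      ≈M-trans (≈M-sym (⊗-assoc E H (H ᵀ))) (⊗-congʳ projector-⊗-self)

    projector-fixes⇔colSub : ∀ {p} (X : Mat m p) → ((projector H ⊗ X) ≈M X) ⇔ ColSub X H
    projector-fixes⇔colSub X = mk⇔
      (λ EX≈X → (H ᵀ) ⊗ X , ≈M-trans (≈M-sym EX≈X) (⊗-assoc H (H ᵀ) X))
      (λ { (C , X≈HC) → begin
        E ⊗ X        ≈⟨ ⊗-congˡ X≈HC ⟩
        E ⊗ (H ⊗ C)  ≈⟨ ⊗-assoc E H C ⟨
        E ⊗ H ⊗ C    ≈⟨ ⊗-congʳ projector-⊗-self ⟩
        H ⊗ C        ≈⟨ X≈HC ⟨
        X            ∎ })

    projector-fixes⇒reflection-fixes : ∀ {p} {X : Mat m p} →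
                                       (projector H ⊗ X) ≈M X → (reflection H ⊗ X) ≈M X
    projector-fixes⇒reflection-fixes {X = X} EX≈X = begin
      S ⊗ X                        ≈⟨ reflection-⊗ H X ⟩
      ((E ⊗ X) ⊕ (E ⊗ X)) ⊖ X      ≈⟨ ⊖-cong (⊕-cong EX≈X EX≈X) ≈M-refl ⟩
      (X ⊕ X) ⊖ X                  ≈⟨ (λ i j → x+x-x≈x (X i j)) ⟩
      X                            ∎

    reflection-⊗-self : (reflection H ⊗ H) ≈M H
    reflection-⊗-self = projector-fixes⇒reflection-fixes projector-⊗-self

    reflection-involutive : (reflection H ⊗ reflection H) ≈M idM
    reflection-involutive = begin
      S ⊗ S                      ≈⟨ reflection-⊗ H S ⟩
      ((E ⊗ S) ⊕ (E ⊗ S)) ⊖ S    ≈⟨ ⊖-cong (⊕-cong E⊗S≈E E⊗S≈E) ≈M-refl ⟩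
      (E ⊕ E) ⊖ S                ≈⟨ (λ i j → x-[x-y]≈y _ (idM i j)) ⟩
      idM                        ∎
      where
      E⊗E≈E : (E ⊗ E) ≈M E
      E⊗E≈E = projector-idempotent
      E⊗S≈E : (E ⊗ S) ≈M E
      E⊗S≈E = begin
        E ⊗ ((E ⊕ E) ⊖ idM)          ≈⟨ ⊗-distribˡ-⊖ E (E ⊕ E) idM ⟩
        (E ⊗ (E ⊕ E)) ⊖ (E ⊗ idM)    ≈⟨ ⊖-cong (⊗-distribˡ-⊕ E E E) (⊗-identityʳ E) ⟩
        ((E ⊗ E) ⊕ (E ⊗ E)) ⊖ E      ≈⟨ ⊖-cong (⊕-cong E⊗E≈E E⊗E≈E) ≈M-refl ⟩
        (E ⊕ E) ⊖ E                  ≈⟨ (λ i j → x+x-x≈x (E i j)) ⟩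
        E                            ∎

    reflection-fixes⇔colSub : (half : Carrier) → (1# + 1#) · half ≈ 1# →
                              ∀ {p} (X : Mat m p) → ((reflection H ⊗ X) ≈M X) ⇔ ColSub X H
    reflection-fixes⇔colSub half two·half≈1 X = ⇔.trans
      (mk⇔ (λ SX≈X i j → x+x-y≈y⇒x≈y half two·half≈1
                            (≈M-trans (≈M-sym (reflection-⊗ H X)) SX≈X i j))
           projector-fixes⇒reflection-fixes)
      (projector-fixes⇔colSub X)

module InvolutionProduct {c ℓ : Level} (R : CommutativeRing c ℓ) {m : ℕ} (S₁ S₂ : LinAlg.Mat R m m)
  where
  open LinAlg R
  open MatrixAlgebra R
  open MatrixPowers R
  open ≈M-Reasoning

  U V : Mat m m
  U = S₁ ⊗ S₂
  V = S₂ ⊗ S₁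

  S₂⊗U≈V⊗S₂ : (S₂ ⊗ U) ≈M (V ⊗ S₂)
  S₂⊗U≈V⊗S₂ = ≈M-sym (⊗-assoc S₂ S₁ S₂)

  module _ (S₁⊗S₁≈I : (S₁ ⊗ S₁) ≈M idM) (S₂⊗S₂≈I : (S₂ ⊗ S₂) ≈M idM) where

    S₁⊗U≈S₂ : (S₁ ⊗ U) ≈M S₂
    S₁⊗U≈S₂ = cancel-inverse S₁ S₁ S₁⊗S₁≈I S₂

    pow-V⊗pow-U≈I : ∀ k → (pow V k ⊗ pow U k) ≈M idM
    pow-V⊗pow-U≈I = pow-inverse V U
      (≈M-trans (⊗-assoc S₂ S₁ U) (≈M-trans (⊗-congˡ S₁⊗U≈S₂) S₂⊗S₂≈I))

    pow-U⊗pow-V≈I : ∀ k → (pow U k ⊗ pow V k) ≈M idM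
    pow-U⊗pow-V≈I = pow-inverse U V
      (≈M-trans (⊗-assoc S₁ S₂ V) (≈M-trans (⊗-congˡ (cancel-inverse S₂ S₂ S₂⊗S₂≈I S₁)) S₁⊗S₁≈I))

    S₁⊗pow-U-suc : ∀ k → (S₁ ⊗ pow U (suc k)) ≈M (pow V k ⊗ S₂)
    S₁⊗pow-U-suc k = begin
      S₁ ⊗ (U ⊗ pow U k)  ≈⟨ ⊗-assoc S₁ U (pow U k) ⟨
      S₁ ⊗ U ⊗ pow U k    ≈⟨ ⊗-congʳ S₁⊗U≈S₂ ⟩
      S₂ ⊗ pow U k        ≈⟨ pow-intertwine S₂ U V S₂⊗U≈V⊗S₂ k ⟩
      pow V k ⊗ S₂        ∎

    odd-power-fixes⇔ : ∀ {n} {X : Mat m n} → (S₂ ⊗ X) ≈M X → ∀ k →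
      ((pow U (suc (2 * k)) ⊗ X) ≈M X) ⇔ ((S₁ ⊗ (pow U (suc k) ⊗ X)) ≈M (pow U (suc k) ⊗ X))
    odd-power-fixes⇔ {X = X} S₂X≈X k = mk⇔
      (λ periodic → begin
        S₁ ⊗ Y                         ≈⟨ S₁Y≈VᵏX ⟩
        pow V k ⊗ X                    ≈⟨ ⊗-congˡ (≈M-trans (≈M-sym periodic) oddPower≈UᵏY) ⟩
        pow V k ⊗ (pow U k ⊗ Y)        ≈⟨ cancel-inverse (pow V k) (pow U k) (pow-V⊗pow-U≈I k) Y ⟩
        Y                              ∎)
      (λ S₁Y≈Y → begin
        pow U (suc (2 * k)) ⊗ X        ≈⟨ oddPower≈UᵏY ⟩
        pow U k ⊗ Y                    ≈⟨ ⊗-congˡ (≈M-trans (≈M-sym S₁Y≈Y) S₁Y≈VᵏX) ⟩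
        pow U k ⊗ (pow V k ⊗ X)        ≈⟨ cancel-inverse (pow U k) (pow V k) (pow-U⊗pow-V≈I k) X ⟩
        X                              ∎)
      where
      Y = pow U (suc k) ⊗ X
      S₁Y≈VᵏX : (S₁ ⊗ Y) ≈M (pow V k ⊗ X)
      S₁Y≈VᵏX = begin
        S₁ ⊗ (pow U (suc k) ⊗ X)   ≈⟨ ⊗-assoc S₁ (pow U (suc k)) X ⟨
        S₁ ⊗ pow U (suc k) ⊗ X     ≈⟨ ⊗-congʳ (S₁⊗pow-U-suc k) ⟩
        pow V k ⊗ S₂ ⊗ X           ≈⟨ ⊗-assoc (pow V k) S₂ X ⟩
        pow V k ⊗ (S₂ ⊗ X)         ≈⟨ ⊗-congˡ S₂X≈X ⟩
        pow V k ⊗ X                ∎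
      oddPower≈UᵏY : (pow U (suc (2 * k)) ⊗ X) ≈M (pow U k ⊗ Y)
      oddPower≈UᵏY = ≈M-trans (⊗-congʳ (pow-odd U k)) (⊗-assoc (pow U k) (pow U (suc k)) X)

module Rank {c ℓ : Level} (R : CommutativeRing c ℓ) where
  open CommutativeRing R hiding (zero) renaming (_*_ to _·_)
  open import Algebra.Properties.Ring ring using (x[y-z]≈xy-xz; -0#≈0#)
  open LinAlg R
  open MatrixAlgebra R
  open SetoidReasoning setoid

  sumF≉0⇒¬¬nonzeroTerm : ∀ n (g : Fin n → Carrier) → ¬ sumF n g ≈ 0# →
                         ¬ ¬ (∃ λ j → ¬ g j ≈ 0#)
  sumF≉0⇒¬¬nonzeroTerm zero    g sum≉0 _    = sum≉0 refl
  sumF≉0⇒¬¬nonzeroTerm (suc n) g sum≉0 none = none (zero , λ g₀≈0 →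
    sumF≉0⇒¬¬nonzeroTerm n (g ∘ suc)
      (λ rest≈0 → sum≉0 (trans (+-cong g₀≈0 rest≈0) (+-identityˡ 0#)))
      (λ (j , gj≉0) → none (suc j , gj≉0)))

  module _ (1≉0 : ¬ 1# ≈ 0#) (inverse : ∀ x → ¬ x ≈ 0# → ∃ λ y → x · y ≈ 1#) where

    eliminate : ∀ {m n} (B : Mat (suc n) (suc m)) (C : Mat (suc m) (suc n)) → (B ⊗ C) ≈M idM →
                ∀ j → ¬ C j zero ≈ 0# → ∃₂ λ (B' : Mat n m) (C' : Mat m n) → (B' ⊗ C') ≈M idM
    eliminate {m} {n} B C BC≈I j pivot≉0 =
      (λ r → removeAt (B' r) j) , removeAt C' j ,
      λ r s → trans (⊗-removeZeroRow B' C' j C'j≈0 r s) (B'C'≈I r s)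
      where
      pivot⁻¹ : Carrier
      pivot⁻¹ = proj₁ (inverse (C j zero) pivot≉0)
      pivot·pivot⁻¹≈1 : C j zero · pivot⁻¹ ≈ 1#
      pivot·pivot⁻¹≈1 = proj₂ (inverse (C j zero) pivot≉0)
      B' : Mat n (suc m)
      B' r = B (suc r)
      -- Subtracting multiples of column zero clears row j, and B'C' stays the identity
      -- because (B ⊗ C) (suc r) zero ≈ 0#.
      C' : Mat (suc m) n
      C' q s = C q (suc s) - C q zero · (pivot⁻¹ · C j (suc s))
      C'j≈0 : ∀ s → C' j s ≈ 0#
      C'j≈0 s = begin
        x - C j zero · (pivot⁻¹ · x)  ≈⟨ +-congˡ (-‿cong (*-assoc _ _ _)) ⟨
        x - C j zero · pivot⁻¹ · x    ≈⟨ +-congˡ (-‿cong (*-congʳ pivot·pivot⁻¹≈1)) ⟩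
        x - 1# · x                    ≈⟨ +-congˡ (-‿cong (*-identityˡ x)) ⟩
        x - x                         ≈⟨ -‿inverseʳ x ⟩
        0#                            ∎
        where x = C j (suc s)
      B'C'≈I : (B' ⊗ C') ≈M idM
      B'C'≈I r s = begin
        sumF (suc m) (λ q → b q · (C q (suc s) - C q zero · d))
          ≈⟨ sumF-cong (suc m) (λ q → x[y-z]≈xy-xz (b q) (C q (suc s)) (C q zero · d)) ⟩
        sumF (suc m) (λ q → b q · C q (suc s) - b q · (C q zero · d))
          ≈⟨ sumF-sub (suc m) (λ q → b q · C q (suc s)) (λ q → b q · (C q zero · d)) ⟩
        (B ⊗ C) (suc r) (suc s) - sumF (suc m) (λ q → b q · (C q zero · d))
          ≈⟨ +-congˡ (-‿cong (sumF-cong (suc m) (λ q → *-assoc (b q) (C q zero) d))) ⟨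
        (B ⊗ C) (suc r) (suc s) - sumF (suc m) (λ q → b q · C q zero · d)
          ≈⟨ +-congˡ (-‿cong (*-distribʳ-sumF (suc m) d (λ q → b q · C q zero))) ⟨
        (B ⊗ C) (suc r) (suc s) - (B ⊗ C) (suc r) zero · d
          ≈⟨ +-cong (BC≈I (suc r) (suc s)) (-‿cong (*-congʳ (trans (BC≈I (suc r) zero) I₁₊ᵣ₀≈0))) ⟩
        idM r s - 0# · d
          ≈⟨ +-congˡ (trans (-‿cong (zeroˡ d)) -0#≈0#) ⟩
        idM r s + 0#
          ≈⟨ +-identityʳ _ ⟩
        idM r s
          ∎
        where
        b = B' r
        d = pivot⁻¹ · C j (suc s)
        I₁₊ᵣ₀≈0 : idM (suc r) zero ≈ 0#
        I₁₊ᵣ₀≈0 = idM-≢ {i = suc r} {zero} λ ()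

    -- ≈ is not decidable, so a nonzero pivot exists only up to double negation; since ≤ is
    -- decidable, decidable-stable recovers the inequality.
    rightInverse⇒¬¬≤ : ∀ m n (B : Mat n m) (C : Mat m n) → (B ⊗ C) ≈M idM → ¬ ¬ (n ≤ m)
    rightInverse⇒¬¬≤ m       zero    B C BC≈I n≰m = n≰m z≤n
    rightInverse⇒¬¬≤ zero    (suc n) B C BC≈I _   =
      1≉0 (trans (sym (idM-≡ {suc n} zero)) (sym (BC≈I zero zero)))
    rightInverse⇒¬¬≤ (suc m) (suc n) B C BC≈I n≰m =
      sumF≉0⇒¬¬nonzeroTerm (suc m) (λ q → B zero q · C q zero)
        (λ BC₀₀≈0 → 1≉0 (trans (sym (trans (BC≈I zero zero) (idM-≡ {suc n} zero))) BC₀₀≈0))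
        λ (j , B₀ⱼCⱼ₀≉0) →
          let (B' , C' , B'C'≈I) = eliminate B C BC≈I j
                                     (λ Cⱼ₀≈0 → B₀ⱼCⱼ₀≉0 (trans (*-congˡ Cⱼ₀≈0) (zeroʳ _)))
          in rightInverse⇒¬¬≤ m n B' C' B'C'≈I (n≰m ∘ s≤s)

    rightInverse⇒≤ : ∀ m n (B : Mat n m) (C : Mat m n) → (B ⊗ C) ≈M idM → n ≤ m
    rightInverse⇒≤ m n B C BC≈I = decidable-stable (n ≤? m) (rightInverse⇒¬¬≤ m n B C BC≈I)

    leftInvertible-colSub⇒≤ : ∀ {m n p} (L : Mat n m) (X : Mat m n) (H : Mat m p) →
                              (L ⊗ X) ≈M idM → ColSub X H → n ≤ p
    leftInvertible-colSub⇒≤ {n = n} {p} L X H LX≈I (C , X≈HC) =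
      rightInverse⇒≤ p n (L ⊗ H) C
        (≈M-trans (⊗-assoc L H C) (≈M-trans (⊗-congˡ (≈M-sym X≈HC)) LX≈I))

module Periodicity {c ℓ : Level} (R : CommutativeRing c ℓ) (F : IsChar0Field R) (X : OrientableMap)
    (rV : Fin (OrientableMap.nV X) → CommutativeRing.Carrier R)
    (rF : Fin (OrientableMap.nF X) → CommutativeRing.Carrier R)
    (hV : MapMatrices.IsInvSqrt R X (MapMatrices.D R X) rV)
    (hF : MapMatrices.IsInvSqrt R X (MapMatrices.Δ R X) rF) where
  open CommutativeRing R hiding (zero) renaming (_*_ to _·_)
  open OrientableMap X
  open MapMatrices R X
  open WithRoots rV rF
  open IsChar0Field F
  open MatrixAlgebra R
  open Reflection R
  open Rank R
  -- projector M̂ and reflection M̂ are definitionally P and 2P − I of WithRoots (likewise for N̂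
  -- and Q), so InvolutionProduct's U is the transition matrix U.
  open InvolutionProduct R (reflection M̂) (reflection N̂)
    using (V; pow-V⊗pow-U≈I; odd-power-fixes⇔)

  1≉0 : ¬ 1# ≈ 0#
  1≉0 1≈0 = char0 0 (trans (+-identityʳ 1#) 1≈0)

  two-invertible : ∃ λ half → (1# + 1#) · half ≈ 1#
  two-invertible = inverse (1# + 1#) (λ 2≈0 → char0 1 (trans (+-congˡ (+-identityʳ 1#)) 2≈0))

  N̂ᵀN̂≈I : ((N̂ ᵀ) ⊗ N̂) ≈M idM
  N̂ᵀN̂≈I = indicator-diag-orthonormal vtx rV hV

  M̂ᵀM̂≈I : ((M̂ ᵀ) ⊗ M̂) ≈M idM
  M̂ᵀM̂≈I = indicator-diag-orthonormal fac rF hF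

  reflectionM̂-involutive : (reflection M̂ ⊗ reflection M̂) ≈M idM
  reflectionM̂-involutive = reflection-involutive M̂ M̂ᵀM̂≈I

  reflectionN̂-involutive : (reflection N̂ ⊗ reflection N̂) ≈M idM
  reflectionN̂-involutive = reflection-involutive N̂ N̂ᵀN̂≈I

  reflectionM̂-fixes⇔colSub : ∀ {p} (Y : Mat nA p) → ((reflection M̂ ⊗ Y) ≈M Y) ⇔ ColSub Y M̂
  reflectionM̂-fixes⇔colSub =
    reflection-fixes⇔colSub M̂ M̂ᵀM̂≈I (proj₁ two-invertible) (proj₂ two-invertible)

  odd-periodic⇔colSub : ∀ k → Periodic (suc (2 * k)) ⇔ ColSub (pow U (suc k) ⊗ N̂) M̂
  odd-periodic⇔colSub k = ⇔.trans
    (odd-power-fixes⇔ reflectionM̂-involutive reflectionN̂-involutive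
                      (reflection-⊗-self N̂ N̂ᵀN̂≈I) k)
    (reflectionM̂-fixes⇔colSub _)

  odd-periodic⇒nV≤nF : ∀ k → Periodic (suc (2 * k)) → nV ≤ nF
  odd-periodic⇒nV≤nF k periodic = leftInvertible-colSub⇒≤ 1≉0 inverse L Y M̂ LY≈I
    (Equivalence.to (odd-periodic⇔colSub k) periodic)
    where
    open ≈M-Reasoning
    Y = pow U (suc k) ⊗ N̂
    L = (N̂ ᵀ) ⊗ pow V (suc k)
    LY≈I : (L ⊗ Y) ≈M idM
    LY≈I = begin
      (N̂ ᵀ) ⊗ pow V (suc k) ⊗ Y       ≈⟨ ⊗-assoc (N̂ ᵀ) (pow V (suc k)) Y ⟩
      (N̂ ᵀ) ⊗ (pow V (suc k) ⊗ Y)     ≈⟨ ⊗-congˡ (cancel-inverse (pow V (suc k)) (pow U (suc k))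
                                          (pow-V⊗pow-U≈I reflectionM̂-involutive
                                                         reflectionN̂-involutive (suc k)) N̂) ⟩
      (N̂ ᵀ) ⊗ N̂                       ≈⟨ N̂ᵀN̂≈I ⟩
      idM                              ∎

  rV≉0 : ∀ w → ¬ rV w ≈ 0#
  rV≉0 w rV≈0 =
    1≉0 (trans (sym (hV w)) (trans (*-congʳ (trans (*-congʳ rV≈0) (zeroˡ _))) (zeroˡ _)))

  N̂-entry : ∀ a w → N̂ a w ≈ N a w · rV w
  N̂-entry = ⊗-diag N rV

  M̂⊗-entry : ∀ {p} (C : Mat nF p) a k → (M̂ ⊗ C) a k ≈ rF (fac a) · C (fac a) k
  M̂⊗-entry C a k = trans (⊗-assoc M (diag rF) C a k)
    (trans (indicator-⊗ fac (diag rF ⊗ C) a k) (diag-⊗ rF C (fac a) k))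

  sameFace⇒sameVertex : ColSub N̂ M̂ → ∀ {a b} → fac a ≡ fac b → vtx a ≡ vtx b
  sameFace⇒sameVertex (C , N̂≈M̂C) {a} {b} fa≡fb with vtx b ≟ vtx a
  ... | yes vb≡va = P.sym vb≡va
  ... | no  vb≢va = ⊥-elim (rV≉0 w (begin
    rV w                        ≈⟨ *-identityˡ (rV w) ⟨
    1# · rV w                   ≈⟨ *-congʳ (indicator-≡ vtx P.refl) ⟨
    N a w · rV w                ≈⟨ N̂-entry a w ⟨
    N̂ a w                       ≈⟨ N̂≈M̂C a w ⟩
    (M̂ ⊗ C) a w                 ≈⟨ M̂⊗-entry C a w ⟩
    rF (fac a) · C (fac a) w    ≡⟨ P.cong (λ f → rF f · C f w) fa≡fb ⟩
    rF (fac b) · C (fac b) w    ≈⟨ M̂⊗-entry C b w ⟨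
    (M̂ ⊗ C) b w                 ≈⟨ N̂≈M̂C b w ⟨
    N̂ b w                       ≈⟨ N̂-entry b w ⟩
    N b w · rV w                ≈⟨ *-congʳ (indicator-≢ vtx vb≢va) ⟩
    0# · rV w                   ≈⟨ zeroˡ (rV w) ⟩
    0#                          ∎))
    where
    open SetoidReasoning setoid
    w = vtx a

  colSub⇒nV≡1 : ColSub N̂ M̂ → nV ≡ 1
  colSub⇒nV≡1 colSub = inhabited-subsingleton⇒≡1 (vtx (fromℕ< nonempty)) all-≡
    where
    vtx-step : ∀ {a b} → Step σ α a b → vtx a ≡ vtx b
    vtx-step (σ-step a) = Equivalence.from (vtx-orbit a (σ a)) (1 , P.refl)
    vtx-step (α-step a) = P.trans
      (sameFace⇒sameVertex colSub (Equivalence.from (fac-orbit a (σ (α a))) (1 , P.refl)))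
      (P.sym (vtx-step (σ-step (α a))))
    all-≡ : ∀ (x y : Fin nV) → x ≡ y
    all-≡ x y with vtx-surj x | vtx-surj y
    ... | a , P.refl | b , P.refl = fold (_≡_ on vtx) (P.trans ∘ vtx-step) P.refl (connected a b)

  nV≡1⇒colSub : nV ≡ 1 → ColSub N̂ M̂
  nV≡1⇒colSub nV≡1 = C , λ a w → begin
    N̂ a w                                   ≈⟨ N̂-entry a w ⟩
    N a w · rV w                            ≈⟨ *-congʳ (indicator-≡ vtx (≡1⇒subsingleton nV≡1 _ _)) ⟩
    1# · rV w                               ≈⟨ *-congʳ (hF (fac a)) ⟨
    rF (fac a) · rF (fac a) · Δ (fac a) (fac a) · rV w
                                            ≈⟨ *-congʳ (*-assoc _ _ _) ⟩
    rF (fac a) · (rF (fac a) · Δ (fac a) (fac a)) · rV w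
                                            ≈⟨ *-assoc _ _ _ ⟩
    rF (fac a) · C (fac a) w                ≈⟨ M̂⊗-entry C a w ⟨
    (M̂ ⊗ C) a w                             ∎
    where
    open SetoidReasoning setoid
    C : Mat nF nV
    C f w = rF f · Δ f f · rV w

  periodic₁⇔nV≡1 : Periodic 1 ⇔ nV ≡ 1
  periodic₁⇔nV≡1 = ⇔.trans (mk⇔ (≈M-trans (≈M-sym U¹N̂≈SN̂)) (≈M-trans U¹N̂≈SN̂))
    (⇔.trans (reflectionM̂-fixes⇔colSub N̂) (mk⇔ colSub⇒nV≡1 nV≡1⇒colSub))
    where
    open ≈M-Reasoning
    U¹N̂≈SN̂ : (pow U 1 ⊗ N̂) ≈M (reflection M̂ ⊗ N̂)
    U¹N̂≈SN̂ = begin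
      U ⊗ idM ⊗ N̂                          ≈⟨ ⊗-congʳ (⊗-identityʳ U) ⟩
      reflection M̂ ⊗ reflection N̂ ⊗ N̂      ≈⟨ ⊗-assoc (reflection M̂) (reflection N̂) N̂ ⟩
      reflection M̂ ⊗ (reflection N̂ ⊗ N̂)    ≈⟨ ⊗-congˡ (reflection-⊗-self N̂ N̂ᵀN̂≈I) ⟩
      reflection M̂ ⊗ N̂                     ∎

lemma5p4 : ∀ {c ℓ : Level} (R : CommutativeRing c ℓ) → IsChar0Field R →
    (X : OrientableMap) →
    (rV : Fin (OrientableMap.nV X) → CommutativeRing.Carrier R) →
    (rF : Fin (OrientableMap.nF X) → CommutativeRing.Carrier R) →
    MapMatrices.IsInvSqrt R X (MapMatrices.D R X) rV →
    MapMatrices.IsInvSqrt R X (MapMatrices.Δ R X) rF →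
    let open MapMatrices R X
        open WithRoots rV rF
    in ((k : ℕ) →
          (Periodic (suc (2 * k)) ⇔ ColSub (pow U (suc k) ⊗ N̂) M̂)
          × (Periodic (suc (2 * k)) → OrientableMap.nV X ≤ OrientableMap.nF X))
       × (Periodic 1 ⇔ OrientableMap.nV X ≡ 1)
lemma5p4 R F X rV rF hV hF =
  (λ k → odd-periodic⇔colSub k , odd-periodic⇒nV≤nF k) , periodic₁⇔nV≡1
  where open Periodicity R F X rV rF hV hF
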